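{- Let $\Gamma$ be a finite thick GQ of order $(s,s)$, and let $X,Y$ be distinct lines meeting in the point $z$, such that the ordered pair $(X,Y)$ satisfies (AR1). Define the incidence structure $\Pi(X,Y)$ whose points are the lines concurrent with $X$ and not incident with $z$, whose lines are (a) the sets $\{Z,X\}^\perp\setminus\{Y\}$ for lines $Z$ concurrent with $Y$ and not incident with $z$, and (b) the points of $X$ different from $z$ (a point $u$ of $X$ being regarded as the set of lines through $u$ other than $X$), with incidence given by containment. Then $\Pi(X,Y)$ is an affine plane of order $s$.
   Context: A finite GQ of order $(s,t)$: every line has $s+1$ points, every point lies on $t+1$ lines, and for each point $p$ and line $L$ not through $p$ exactly one point of $L$ is collinear with $p$; thick means $s,t\ge2$. For lines $L,M$, $\{L,M\}^\perp$ is the set of lines concurrent with both $L$ and $M$. A triad of lines is a set of three pairwise nonconcurrent lines; a center of it is a line concurrent with all three. The ordered pair $(X,Y)$ of distinct lines through $z$ satisfies (AR1) if no triad $\{X,V,W\}$ of lines having $Y$ as a center has more than one center not incident with $z$. -}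

module Defs where

open import Data.Nat using (ℕ; suc)
open import Data.Fin using (Fin)
open import Data.Fin.Subset using (Subset; _∈_; _∉_; ∣_∣)
open import Data.Product using (Σ; _×_; _,_)
open import Data.Sum using (_⊎_)
open import Relation.Binary.PropositionalEquality using (_≡_; _≢_)
open import Relation.Nullary using (¬_)
open import Function.Bundles using (_⇔_)

HasSize : (n : ℕ) → (Fin n → Set) → ℕ → Set
HasSize n P k = Σ (Subset n) λ S → (∀ x → (x ∈ S) ⇔ P x) × ∣ S ∣ ≡ k

record GQ (s t : ℕ) : Set₁ where
  field
    np nl : ℕ
    Inc : Fin np → Fin nl → Set
    linePts : ∀ (L : Fin nl) → HasSize np (λ p → Inc p L) (suc s)
    ptLines : ∀ (p : Fin np) → HasSize nl (λ L → Inc p L) (suc t)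
    atMostOneLine : ∀ (p q : Fin np) (L M : Fin nl) → p ≢ q →
                    Inc p L → Inc q L → Inc p M → Inc q M → L ≡ M
    gqAxiom : ∀ (p : Fin np) (L : Fin nl) → ¬ Inc p L →
              HasSize np (λ q → Inc q L × Σ (Fin nl) (λ M → Inc p M × Inc q M)) 1

module _ {s t : ℕ} (Γ : GQ s t) where
  open GQ Γ

  Concurrent : Fin nl → Fin nl → Set
  Concurrent L M = Σ (Fin np) λ p → Inc p L × Inc p M

  Perp : Fin nl → Fin nl → Fin nl → Set
  Perp L M W = Concurrent W L × Concurrent W M

  Triad : Fin nl → Fin nl → Fin nl → Set
  Triad A B C = ¬ Concurrent A B × ¬ Concurrent A C × ¬ Concurrent B C

  IsCenter : Fin nl → Fin nl → Fin nl → Fin nl → Set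
  IsCenter A B C W = Concurrent W A × Concurrent W B × Concurrent W C

  AR1 : Fin np → Fin nl → Fin nl → Set
  AR1 z X Y = ∀ (V W : Fin nl) → Triad X V W → IsCenter X V W Y →
              ∀ (C C' : Fin nl) → IsCenter X V W C → ¬ Inc z C →
              IsCenter X V W C' → ¬ Inc z C' → C ≡ C'

  ΠPoint : Fin np → Fin nl → Fin nl → Set
  ΠPoint z X M = Concurrent M X × ¬ Inc z M

  ΠLine : Fin np → Fin nl → Fin nl → Subset nl → Set
  ΠLine z X Y S =
      Σ (Fin nl) (λ Z → Concurrent Z Y × ¬ Inc z Z ×
           (∀ W → (W ∈ S) ⇔ (Perp Z X W × W ≢ Y)))
    ⊎
      Σ (Fin np) (λ u → Inc u X × u ≢ z ×
           (∀ W → (W ∈ S) ⇔ (Inc u W × W ≢ X)))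

-- An incidence structure whose points are the x : Fin n with IsPt x and whose
-- lines are the subsets S with IsLn S (incidence = membership) is an affine
-- plane of order k.
record IsAffinePlane (n : ℕ) (IsPt : Fin n → Set) (IsLn : Subset n → Set) (k : ℕ) : Set where
  field
    linesOfPoints : ∀ S → IsLn S → ∀ x → x ∈ S → IsPt x
    joinExists : ∀ p q → IsPt p → IsPt q → p ≢ q →
                 Σ (Subset n) λ S → IsLn S × p ∈ S × q ∈ S
    joinUnique : ∀ p q → IsPt p → IsPt q → p ≢ q → ∀ S S' →
                 IsLn S → p ∈ S → q ∈ S → IsLn S' → p ∈ S' → q ∈ S' → S ≡ S'
    parallelExists : ∀ S p → IsLn S → IsPt p → p ∉ S →
                     Σ (Subset n) λ S' → IsLn S' × p ∈ S' × (∀ x → x ∈ S' → x ∉ S)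
    parallelUnique : ∀ S p → IsLn S → IsPt p → p ∉ S → ∀ S₁ S₂ →
                     IsLn S₁ → p ∈ S₁ → (∀ x → x ∈ S₁ → x ∉ S) →
                     IsLn S₂ → p ∈ S₂ → (∀ x → x ∈ S₂ → x ∉ S) → S₁ ≡ S₂
    nonDegenerate : Σ (Fin n) λ a → Σ (Fin n) λ b → Σ (Fin n) λ c →
                    IsPt a × IsPt b × IsPt c ×
                    (∀ S → IsLn S → a ∈ S → b ∈ S → c ∉ S)
    order : ∀ S → IsLn S → ∣ S ∣ ≡ k

module Submission where

-- A line of Π(X,Y) is named by a key: an admissible line Z (concurrent with
-- Y, not through z), naming the type (a) line {Z,X}^⊥ \ {Y}, or a point
-- u ≠ z of X, naming the type (b) line "pencil at u".  The geometry
-- rests on four intersection facts: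
--   * a type (a) line and a pencil share exactly one Π-point (no triangles);
--   * distinct type (a) lines share at most one Π-point -- this is (AR1);
--   * type (a) lines of distinct admissible lines through one point of Y are
--     disjoint, those through distinct points of Y meet;
--   * Π-points meeting X in distinct points lie on a common type (a) line.
-- The existence statements among these are counting arguments: an injection
-- between two sets of size s is onto.

open import Defs
open import Data.Nat using (ℕ; suc; _≤_; z≤n; s≤s)
open import Data.Nat.Properties using (≤-antisym; ≤-trans; ≤-reflexive; suc-injective)
open import Data.Fin using (Fin; zero; suc)
open import Data.Fin.Properties using (any?; 0≢1+n) renaming (_≟_ to _≟ᶠ_; suc-injective to fsuc-injective)
open import Data.Fin.Subset using (Subset; _∈_; _∉_; ∣_∣; _-_; inside; outside)
open import Data.Fin.Subset.Properties
  using (_∈?_; ⊆-antisym; p─⊥≡p; p─q⊆p; x∈p∧x≢y⇒x∈p-y; nonempty?; Empty-unique; ∣⊥∣≡0)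
open import Data.Vec using ([]; _∷_; here; there; tabulate)
open import Data.Vec.Properties using (lookup∘tabulate; []=⇒lookup; lookup⇒[]=)
open import Data.Product using (Σ; _×_; _,_; proj₁; proj₂)
open import Data.Sum using (_⊎_; inj₁; inj₂)
open import Data.Empty using (⊥; ⊥-elim)
open import Function using (_∘_; _⇔_; mk⇔; Equivalence)
open import Relation.Binary.PropositionalEquality using (_≡_; _≢_; refl; sym; trans; cong; subst)
open import Relation.Nullary using (¬_; Dec; yes; no; does)
open import Relation.Nullary.Decidable using (_×-dec_; ¬?; dec-true; decidable-stable)
import Relation.Nullary.Decidable as Dec

open Equivalence using (to; from)

private
  variable
    n : ℕ
    P : Fin n → Set

size-remove : ∀ {x : Fin n} (p : Subset n) → x ∈ p → suc ∣ p - x ∣ ≡ ∣ p ∣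
size-remove (inside ∷ p) here = cong (suc ∘ ∣_∣) (p─⊥≡p p)
size-remove (inside ∷ p) (there x∈p) = cong suc (size-remove p x∈p)
size-remove (outside ∷ p) (there x∈p) = size-remove p x∈p

x∉p-x : ∀ {x : Fin n} (p : Subset n) → x ∉ p - x
x∉p-x {x = zero} (b ∷ p) ()
x∉p-x {x = suc x} (b ∷ p) (there x∈p-x) = x∉p-x p x∈p-x

comprehension : (∀ x → Dec (P x)) →
                Σ (Subset n) λ S → ∀ x → x ∈ S ⇔ P x
comprehension {P = P} P? = tabulate (does ∘ P?) , λ x → mk⇔ (member⇒ x) (⇒member x)
  where
    member⇒ : ∀ x → x ∈ tabulate (does ∘ P?) → P x
    member⇒ x x∈S with P? x | trans (sym (lookup∘tabulate (does ∘ P?) x)) ([]=⇒lookup x∈S)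
    ... | yes Px | _ = Px
    ... | no _ | ()
    ⇒member : ∀ x → P x → x ∈ tabulate (does ∘ P?)
    ⇒member x Px = lookup⇒[]= x _ (trans (lookup∘tabulate (does ∘ P?) x) (dec-true (P? x) Px))

extensional : ∀ {S T : Subset n} →
              (∀ x → x ∈ S ⇔ P x) → (∀ x → x ∈ T ⇔ P x) → S ≡ T
extensional S⇔P T⇔P =
  ⊆-antisym (λ {x} x∈S → from (T⇔P x) (to (S⇔P x) x∈S))
            (λ {x} x∈T → from (S⇔P x) (to (T⇔P x) x∈T))

represented-size : ∀ {S k} → (∀ x → x ∈ S ⇔ P x) → HasSize n P k → ∣ S ∣ ≡ k
represented-size S⇔P (T , T⇔P , ∣T∣≡k) = trans (cong ∣_∣ (extensional S⇔P T⇔P)) ∣T∣≡k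

HasSize-remove : ∀ {k a} → HasSize n P (suc k) → P a → HasSize n (λ x → P x × x ≢ a) k
HasSize-remove {a = a} (S , S⇔P , ∣S∣≡1+k) Pa =
  S - a ,
  (λ x → mk⇔ (λ x∈S-a → to (S⇔P x) (p─q⊆p S _ x∈S-a) , λ { refl → x∉p-x S x∈S-a })
             (λ (Px , x≢a) → x∈p∧x≢y⇒x∈p-y (from (S⇔P x) Px) x≢a)) ,
  suc-injective (trans (size-remove S (from (S⇔P a) Pa)) ∣S∣≡1+k)

HasSize-empty : ∀ {x} → HasSize n P 0 → ¬ P x
HasSize-empty (S , S⇔P , ∣S∣≡0) Px with trans (size-remove S (from (S⇔P _) Px)) ∣S∣≡0
... | ()

HasSize-witness : ∀ {k} → HasSize n P (suc k) → Σ (Fin n) P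
HasSize-witness {n = n} (S , S⇔P , ∣S∣≡1+k) with nonempty? S
... | yes (x , x∈S) = x , to (S⇔P x) x∈S
... | no S-empty with trans (sym (trans (cong ∣_∣ (Empty-unique S-empty)) (∣⊥∣≡0 n))) ∣S∣≡1+k
...   | ()

HasSize-two : ∀ {k} → HasSize n P k → 2 ≤ k → Σ (Fin n) λ x → Σ (Fin n) λ y → P x × P y × x ≢ y
HasSize-two size (s≤s (s≤s _)) with HasSize-witness size
... | x , Px with HasSize-witness (HasSize-remove size Px)
...   | y , Py , y≢x = x , y , Px , Py , y≢x ∘ sym

HasSize-one : ∀ {x y} → HasSize n P 1 → P x → P y → x ≡ y
HasSize-one size Px Py =
  decidable-stable (_ ≟ᶠ _) λ x≢y → HasSize-empty (HasSize-remove size Px) (Py , x≢y ∘ sym)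

-- An injective correspondence R from the P-elements to the Q-elements: every
-- P-element is related to some Q-element, and no Q-element is related to two
-- different P-elements.  (R need not be a function, which lets the image be
-- chosen by a proof rather than computed.)
record Injection {m n : ℕ} (P : Fin m → Set) (Q : Fin n → Set) (R : Fin m → Fin n → Set) : Set where
  field
    image     : ∀ {x} → P x → Σ (Fin n) λ y → Q y × R x y
    injective : ∀ {x x' y} → P x → P x' → Q y → R x y → R x' y → x ≡ x'

open Injection

restrict : ∀ {m n b} {S : Subset m} {Q : Fin n → Set} {R} →
           Injection (_∈ b ∷ S) Q R → Injection (_∈ S) Q (R ∘ suc)
restrict f = record
  { image     = image f ∘ there
  ; injective = λ x∈S x'∈S Qy r r' → fsuc-injective (injective f (there x∈S) (there x'∈S) Qy r r')
  }

-- Removing zero from the domain and its image y₀ from the codomain: by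
-- injectivity no other element is sent to y₀.
avoid : ∀ {m n} {S : Subset m} {T : Subset n} {R} (f : Injection (_∈ inside ∷ S) (_∈ T) R) →
        Injection (_∈ S) (_∈ T - proj₁ (image f here)) (R ∘ suc)
avoid {T = T} {R} f = record
  { image     = λ {x} x∈S → let (y , y∈T , r) = image f (there x∈S) in
      y , x∈p∧x≢y⇒x∈p-y y∈T (λ y≡y₀ → 0≢1+n (injective f here (there x∈S) y₀∈T r₀
                                                         (subst (R (suc x)) y≡y₀ r))) , r
  ; injective = λ x∈S x'∈S y∈T-y₀ → injective (restrict f) x∈S x'∈S (p─q⊆p T _ y∈T-y₀)
  }
  where
    y₀∈T = proj₁ (proj₂ (image f here))
    r₀   = proj₂ (proj₂ (image f here))

injection-≤ : ∀ {m n R} (S : Subset m) (T : Subset n) →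
              Injection (_∈ S) (_∈ T) R → ∣ S ∣ ≤ ∣ T ∣
injection-≤ [] T f = z≤n
injection-≤ (outside ∷ S) T f = injection-≤ S T (restrict f)
injection-≤ (inside ∷ S) T f =
  ≤-trans (s≤s (injection-≤ S _ (avoid f)))
          (≤-reflexive (size-remove T (proj₁ (proj₂ (image f here)))))

injection-onto : ∀ {m n R} (S : Subset m) (T : Subset n) → Injection (_∈ S) (_∈ T) R →
                 ∣ T ∣ ≤ ∣ S ∣ → ∀ {y} → y ∈ T → Σ (Fin m) λ x → x ∈ S × R x y
injection-onto [] T f ∣T∣≤0 y∈T with ≤-trans (≤-reflexive (size-remove T y∈T)) ∣T∣≤0
... | ()
injection-onto (outside ∷ S) T f ∣T∣≤∣S∣ y∈T =
  let (x , x∈S , r) = injection-onto S T (restrict f) ∣T∣≤∣S∣ y∈T in suc x , there x∈S , r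
injection-onto (inside ∷ S) T f ∣T∣≤∣S∣ {y} y∈T with y ≟ᶠ proj₁ (image f here)
... | yes refl = zero , here , proj₂ (proj₂ (image f here))
... | no y≢y₀ =
  let (x , x∈S , r) = injection-onto S _ (avoid f) ∣T-y₀∣≤∣S∣ (x∈p∧x≢y⇒x∈p-y y∈T y≢y₀)
  in suc x , there x∈S , r
  where
    ∣T-y₀∣≤∣S∣ : ∣ T - proj₁ (image f here) ∣ ≤ ∣ S ∣
    ∣T-y₀∣≤∣S∣ with ≤-trans (≤-reflexive (size-remove T (proj₁ (proj₂ (image f here)))))
                             ∣T∣≤∣S∣
    ... | s≤s le = le

on-subsets : ∀ {m n} {P : Fin m → Set} {Q : Fin n → Set} {R S T} →
             (∀ x → x ∈ S ⇔ P x) → (∀ y → y ∈ T ⇔ Q y) →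
             Injection P Q R → Injection (_∈ S) (_∈ T) R
on-subsets S⇔P T⇔Q f = record
  { image     = λ {x} x∈S → let (y , Qy , r) = image f (to (S⇔P x) x∈S) in y , from (T⇔Q y) Qy , r
  ; injective = λ x∈S x'∈S y∈T → injective f (to (S⇔P _) x∈S) (to (S⇔P _) x'∈S) (to (T⇔Q _) y∈T)
  }

HasSize-≤ : ∀ {m n a b} {P : Fin m → Set} {Q : Fin n → Set} {R} →
            HasSize m P a → HasSize n Q b → Injection P Q R → a ≤ b
HasSize-≤ (S , S⇔P , refl) (T , T⇔Q , refl) f = injection-≤ S T (on-subsets S⇔P T⇔Q f)

HasSize-onto : ∀ {m n k} {P : Fin m → Set} {Q : Fin n → Set} {R} →
               HasSize m P k → HasSize n Q k → Injection P Q R →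
               ∀ {y} → Q y → Σ (Fin m) λ x → P x × R x y
HasSize-onto (S , S⇔P , ∣S∣≡k) (T , T⇔Q , ∣T∣≡k) f {y} Qy =
  let (x , x∈S , r) = injection-onto S T (on-subsets S⇔P T⇔Q f)
                        (≤-reflexive (trans ∣T∣≡k (sym ∣S∣≡k))) (from (T⇔Q y) Qy)
  in x , to (S⇔P x) x∈S , r

module GQFacts {s t : ℕ} (Γ : GQ s t) where
  open GQ Γ

  Point Line : Set
  Point = Fin np
  Line  = Fin nl

  private
    variable
      p q r a b : Point
      L M A B Z Z' : Line

  Inc? : ∀ p L → Dec (Inc p L)
  Inc? p L = let (S , S⇔Inc , _) = linePts L in Dec.map (S⇔Inc p) (p ∈? S)

  Concurrent? : ∀ L M → Dec (Concurrent Γ L M)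
  Concurrent? L M = any? λ p → Inc? p L ×-dec Inc? p M

  concurrent-sym : Concurrent Γ L M → Concurrent Γ M L
  concurrent-sym (p , pL , pM) = p , pM , pL

  same-line : p ≢ q → Inc p L → Inc q L → Inc p M → Inc q M → L ≡ M
  same-line p≢q = atMostOneLine _ _ _ _ p≢q

  off-line : Inc p L → ¬ Inc q L → p ≢ q
  off-line pL ¬qL refl = ¬qL pL

  unique-foot : ∀ {q q' M M'} → ¬ Inc p L → Inc q L → Inc p M → Inc q M →
                Inc q' L → Inc p M' → Inc q' M' → q ≡ q'
  unique-foot ¬pL qL pM qM q'L pM' q'M' =
    HasSize-one (gqAxiom _ _ ¬pL) (qL , _ , pM , qM) (q'L , _ , pM' , q'M')

  record Foot (p : Point) (L : Line) : Set where
    field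
      point     : Point
      point∈L   : Inc point L
      line      : Line
      p∈line    : Inc p line
      point∈line : Inc point line

  foot : ¬ Inc p L → Foot p L
  foot ¬pL = let (q , qL , M , pM , qM) = HasSize-witness (gqAxiom _ _ ¬pL)
             in record { point = q ; point∈L = qL ; line = M ; p∈line = pM ; point∈line = qM }

  unique-line-toward : ¬ Inc r A → Inc r Z → Inc p Z → Inc p A →
                       Inc r Z' → Inc q Z' → Inc q A → Z ≡ Z'
  unique-line-toward ¬rA rZ pZ pA rZ' qZ' qA with unique-foot ¬rA pA rZ pZ qA rZ' qZ'
  ... | refl = same-line (off-line pA ¬rA ∘ sym) rZ pZ rZ' qZ'

  no-triangle : A ≢ L → B ≢ L → Inc a A → Inc a L → Inc b B → Inc b L → a ≢ b →
                ¬ Concurrent Γ A B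
  no-triangle {a = a} A≢L B≢L aA aL bB bL a≢b (r , rA , rB) with r ≟ᶠ a
  ... | yes refl = B≢L (same-line a≢b rB bB aL bL)
  ... | no r≢a   = a≢b (unique-foot (λ rL → A≢L (same-line r≢a rA aA rL aL)) aL rA aA bL rB bB)

  perp-nonconcurrent : ¬ Concurrent Γ A B → Z ≢ Z' → Perp Γ A B Z → Perp Γ A B Z' →
                       ¬ Concurrent Γ Z Z'
  perp-nonconcurrent {A = A} ¬AB Z≢Z' ((p , pZ , pA) , (q , qZ , qB))
                     ((p' , p'Z' , p'A) , (q' , q'Z' , q'B)) (r , rZ , rZ') with Inc? r A
  ... | yes rA = Z≢Z' (unique-line-toward (λ rB → ¬AB (r , rA , rB)) rZ qZ qB rZ' q'Z' q'B)
  ... | no ¬rA = Z≢Z' (unique-line-toward ¬rA rZ pZ pA rZ' p'Z' p'A)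

module Configuration {s : ℕ} (Γ : GQ s s) (X Y : Fin (GQ.nl Γ)) (z : Fin (GQ.np Γ))
                     (X≢Y : X ≢ Y) (zX : GQ.Inc Γ z X) (zY : GQ.Inc Γ z Y)
                     (ar1 : AR1 Γ z X Y) where
  open GQ Γ
  open GQFacts Γ

  private
    variable
      r y y' u u' a b c c' : Point
      A B W W' Z Z' Z₁ : Line

  ΠPt : Line → Set
  ΠPt = ΠPoint Γ z X

  Admissible : Line → Set
  Admissible Z = Concurrent Γ Z Y × ¬ Inc z Z

  PerpLine : Line → Line → Set
  PerpLine Z W = Perp Γ Z X W × W ≢ Y

  Pencil : Point → Line → Set
  Pencil u W = Inc u W × W ≢ X

  X∩Y≡z : Inc y X → Inc y Y → y ≡ z
  X∩Y≡z yX yY = decidable-stable (_ ≟ᶠ z) λ y≢z → X≢Y (same-line y≢z yX zX yY zY)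

  pencil-unique : Inc u X → Inc u' X → Pencil u W → Pencil u' W → u ≡ u'
  pencil-unique uX u'X (uW , W≢X) (u'W , _) =
    decidable-stable (_ ≟ᶠ _) λ u≢u' → W≢X (same-line u≢u' uW u'W uX u'X)

  -- An admissible line does not meet X (it would form a triangle with X, Y).
  admissible-¬X : Admissible Z → ¬ Concurrent Γ Z X
  admissible-¬X {Z} ((y , yZ , yY) , ¬zZ) (q , qZ , qX) =
    ¬zZ (subst (λ w → Inc w Z) (unique-foot ¬yX qX yZ qZ zX yY zY) qZ)
    where
      ¬yX : ¬ Inc y X
      ¬yX yX = ¬zZ (subst (λ w → Inc w Z) (X∩Y≡z yX yY) yZ)

  admissible-through : Inc y Y → y ≢ z → Inc y Z → Z ≢ Y → Admissible Z
  admissible-through yY y≢z yZ Z≢Y = (_ , yZ , yY) , λ zZ → Z≢Y (same-line (y≢z ∘ sym) zZ yZ zY yY)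

  admissible-distinct : Admissible Z → Inc y Z → Inc y Y → Inc y' Z' → Inc y' Y → y ≢ y' → Z ≢ Z'
  admissible-distinct (_ , ¬zZ) yZ yY y'Z' y'Y y≢y' refl =
    ¬zZ (subst (Inc z) (sym (same-line y≢y' yZ y'Z' yY y'Y)) zY)

  admissible≢Y : Admissible Z → Z ≢ Y
  admissible≢Y (_ , ¬zZ) refl = ¬zZ zY

  ΠPt≢X : ΠPt A → A ≢ X
  ΠPt≢X (_ , ¬zA) refl = ¬zA zX

  ΠPt≢Y : ΠPt A → A ≢ Y
  ΠPt≢Y (_ , ¬zA) refl = ¬zA zY

  ΠPt-misses-Y : ΠPt A → Inc r A → ¬ Inc r Y
  ΠPt-misses-Y {A} ((a , aA , aX) , ¬zA) rA rY with unique-foot ¬zA rA zY rY aA zX aX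
  ... | refl = ¬zA (subst (λ w → Inc w A) (X∩Y≡z aX rY) aA)

  -- Members of both kinds of lines are Π-points; for type (a) the point to
  -- check is that W ∌ z (else Z, W, Y would form a triangle).
  perpLine-avoids-z : Admissible Z → PerpLine Z W → ¬ Inc z W
  perpLine-avoids-z ((y , yZ , yY) , ¬zZ) (((w , wW , wZ) , _) , W≢Y) zW
    with unique-foot ¬zZ wZ zW wW yZ zY yY
  ... | refl = W≢Y (same-line (off-line wZ ¬zZ ∘ sym) zW wW zY yY)

  perpLine-ΠPt : Admissible Z → PerpLine Z W → ΠPt W
  perpLine-ΠPt adm W∈Z@((_ , W∩X) , _) = W∩X , perpLine-avoids-z adm W∈Z

  pencil-ΠPt : Inc u X → u ≢ z → Pencil u W → ΠPt W
  pencil-ΠPt uX u≢z (uW , W≢X) = (_ , uW , uX) , λ zW → W≢X (same-line u≢z uW zW uX zX)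

  perp-pencil-meet-once : Admissible Z → Inc u X → A ≢ B → Inc u A → Inc u B →
                          PerpLine Z A → PerpLine Z B → ⊥
  perp-pencil-meet-once adm uX A≢B uA uB (((p , pA , pZ) , _) , _) (((q , qB , qZ) , _) , _) =
    A≢B (unique-line-toward (λ uZ → admissible-¬X adm (_ , uZ , uX)) uA pA pZ uB qB qZ)

  -- Two distinct type (a) lines have at most one common Π-point.  This is
  -- where (AR1) enters: two common points would be two centers of the triad
  -- {X,Z,Z'} not through z.
  perp-perp-meet-once : Admissible Z → Admissible Z' → Z ≢ Z' → A ≢ B →
                        PerpLine Z A → PerpLine Z B → PerpLine Z' A → PerpLine Z' B → ⊥
  perp-perp-meet-once {Z} {Z'} {A} {B} adm adm' Z≢Z' A≢B
                      A∈Z@((AZ , a , aA , aX) , _) B∈Z@((BZ , b , bB , bX) , _)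
                      ((AZ' , _) , _) ((BZ' , _) , _) with a ≟ᶠ b
  ... | yes refl = perp-pencil-meet-once adm aX A≢B aA bB A∈Z B∈Z
  ... | no a≢b = A≢B (ar1 Z Z' triad centerY A B centerA (perpLine-avoids-z adm A∈Z)
                                              centerB (perpLine-avoids-z adm B∈Z))
    where
      ¬AB = no-triangle (ΠPt≢X (perpLine-ΠPt adm A∈Z)) (ΠPt≢X (perpLine-ΠPt adm B∈Z)) aA aX bB bX a≢b
      triad = admissible-¬X adm ∘ concurrent-sym , admissible-¬X adm' ∘ concurrent-sym ,
              perp-nonconcurrent ¬AB Z≢Z' (concurrent-sym AZ , concurrent-sym BZ)
                                          (concurrent-sym AZ' , concurrent-sym BZ')
      centerY = (z , zY , zX) , concurrent-sym (proj₁ adm) , concurrent-sym (proj₁ adm')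
      centerA = (a , aA , aX) , AZ , AZ'
      centerB = (b , bB , bX) , BZ , BZ'

  perps-through-y-disjoint : Admissible Z → Admissible Z' → Z ≢ Z' → Inc y Z → Inc y Z' → Inc y Y →
                             PerpLine Z W → PerpLine Z' W → ⊥
  perps-through-y-disjoint {W = W} adm adm' Z≢Z' yZ yZ' yY W∈Z@(((w , wW , wZ) , _) , _)
                           (((w' , w'W , w'Z') , _) , _) with Inc? _ W
  ... | yes yW = ΠPt-misses-Y (perpLine-ΠPt adm W∈Z) yW yY
  ... | no ¬yW = Z≢Z' (unique-line-toward ¬yW yZ wZ wW yZ' w'Z' w'W)

  perp-through : Inc y Y → y ≢ z → ΠPt A → Σ Line λ Z → Inc y Z × Admissible Z × PerpLine Z A
  perp-through yY y≢z A∈Π@(A∩X , _) =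
    line , p∈line , admissible-through yY y≢z p∈line line≢Y ,
    ((point , point∈L , point∈line) , A∩X) , ΠPt≢Y A∈Π
    where
      open Foot (foot λ yA → ΠPt-misses-Y A∈Π yA yY)
      line≢Y : line ≢ Y
      line≢Y line≡Y = ΠPt-misses-Y A∈Π point∈L (subst (Inc point) line≡Y point∈line)

  -- Every type (a) line meets every type (b) line: for u ∈ X, u ≠ z, take the
  -- line through u meeting Z.
  perp-meets-pencil : Admissible Z → Inc u X → u ≢ z → Σ Line λ W → PerpLine Z W × Pencil u W
  perp-meets-pencil adm uX u≢z =
    line , (((point , point∈line , point∈L) , (_ , p∈line , uX)) , line≢Y) , p∈line , line≢X
    where
      open Foot (foot λ uZ → admissible-¬X adm (_ , uZ , uX))
      line≢Y : line ≢ Y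
      line≢Y line≡Y = u≢z (X∩Y≡z uX (subst (Inc _) line≡Y p∈line))
      line≢X : line ≢ X
      line≢X line≡X = admissible-¬X adm (point , point∈L , subst (Inc point) line≡X point∈line)

  PerpLine? : ∀ Z W → Dec (PerpLine Z W)
  PerpLine? Z W = (Concurrent? W Z ×-dec Concurrent? W X) ×-dec ¬? (W ≟ᶠ Y)

  Pencil? : ∀ u W → Dec (Pencil u W)
  Pencil? u W = Inc? u W ×-dec ¬? (W ≟ᶠ X)

  pencil-size : Inc u X → HasSize nl (Pencil u) s
  pencil-size uX = HasSize-remove (ptLines _) uX

  -- Every type (a) line has s points: its members correspond bijectively,
  -- via their intersection with Z, to the points of Z other than Z ∩ Y.
  perpLine-size : Admissible Z → HasSize nl (PerpLine Z) s
  perpLine-size {Z} adm@((y , yZ , yY) , ¬zZ) = S , S⇔ , ≤-antisym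
      (HasSize-≤ size-S points-of-Z (record { image = meet-Z ; injective = meet-Z-injective }))
      (HasSize-≤ points-of-Z size-S (record { image = line-to-X ; injective = line-to-X-injective }))
    where
      S = proj₁ (comprehension (PerpLine? Z))
      S⇔ = proj₂ (comprehension (PerpLine? Z))
      size-S : HasSize nl (PerpLine Z) ∣ S ∣
      size-S = S , S⇔ , refl
      points-of-Z : HasSize np (λ c → Inc c Z × c ≢ y) s
      points-of-Z = HasSize-remove (linePts Z) yZ
      ¬X : ∀ {c} → Inc c Z → ¬ Inc c X
      ¬X cZ cX = admissible-¬X adm (_ , cZ , cX)

      meet-Z : PerpLine Z W → Σ Point λ c → (Inc c Z × c ≢ y) × Inc c W
      meet-Z W∈Z@(((c , cW , cZ) , (e , eW , eX)) , _) = c , (cZ , c≢y) , cW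
        where
          c≢y : c ≢ y
          c≢y refl = perpLine-avoids-z adm W∈Z
                       (subst (λ w → Inc w _) (unique-foot (¬X yZ) eX cW eW zX yY zY) eW)
      meet-Z-injective : PerpLine Z W → PerpLine Z W' → Inc c Z × c ≢ y → Inc c W → Inc c W' → W ≡ W'
      meet-Z-injective (((_ , (e , eW , eX)) , _)) (((_ , (e' , e'W' , e'X)) , _)) (cZ , _) cW cW' =
        unique-line-toward (¬X cZ) cW eW eX cW' e'W' e'X

      line-to-X : Inc c Z × c ≢ y → Σ Line λ W → PerpLine Z W × Inc c W
      line-to-X (cZ , c≢y) =
        line , (((_ , p∈line , cZ) , (point , point∈line , point∈L)) , line≢Y) , p∈line
        where
          open Foot (foot (¬X cZ))
          line≢Y : line ≢ Y
          line≢Y line≡Y = admissible-distinct adm yZ yY cZ (subst (Inc _) line≡Y p∈line) (c≢y ∘ sym) refl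
      line-to-X-injective : Inc c Z × c ≢ y → Inc c' Z × c' ≢ y → PerpLine Z W →
                            Inc c W → Inc c' W → c ≡ c'
      line-to-X-injective (cZ , _) (c'Z , _) ((_ , (e , eW , eX)) , _) cW c'W =
        decidable-stable (_ ≟ᶠ _) λ c≢c' →
          admissible-¬X adm (e , subst (Inc e) (same-line c≢c' cW c'W cZ c'Z) eW , eX)

  -- Counting: sending a member A of the first line to the admissible
  -- line through y' whose type (a) line contains A is injective (two common
  -- members are excluded by perp-perp-meet-once) between two sets of size s,
  -- hence onto; so Z' is hit.
  perps-meet : Admissible Z → Admissible Z' → Inc y Z → Inc y Y → Inc y' Z' → Inc y' Y → y ≢ y' →
               Σ Line λ W → PerpLine Z W × PerpLine Z' W
  perps-meet {Z} {Z'} {y} {y'} adm adm' yZ yY y'Z' y'Y y≢y' =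
    let (W , W∈Z , W∈Z') = HasSize-onto (perpLine-size adm) (HasSize-remove (ptLines y') y'Y)
                             (record { image = through-y' ; injective = through-y'-injective })
                             (y'Z' , admissible≢Y adm')
    in W , W∈Z , W∈Z'
    where
      y'≢z : y' ≢ z
      y'≢z refl = proj₂ adm' y'Z'
      through-y' : PerpLine Z A → Σ Line λ Z₁ → (Inc y' Z₁ × Z₁ ≢ Y) × PerpLine Z₁ A
      through-y' A∈Z = let (Z₁ , y'Z₁ , adm₁ , A∈Z₁) = perp-through y'Y y'≢z (perpLine-ΠPt adm A∈Z)
                  in Z₁ , (y'Z₁ , admissible≢Y adm₁) , A∈Z₁
      through-y'-injective : PerpLine Z A → PerpLine Z B → Inc y' Z₁ × Z₁ ≢ Y →
                             PerpLine Z₁ A → PerpLine Z₁ B → A ≡ B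
      through-y'-injective A∈Z B∈Z (y'Z₁ , Z₁≢Y) A∈Z₁ B∈Z₁ =
        decidable-stable (_ ≟ᶠ _) λ A≢B →
          perp-perp-meet-once adm adm₁ (admissible-distinct adm yZ yY y'Z₁ y'Y y≢y') A≢B
                              A∈Z B∈Z A∈Z₁ B∈Z₁
        where adm₁ = admissible-through y'Y y'≢z y'Z₁ Z₁≢Y

  -- Counting: for y ≠ z on Y let Z_y be the admissible line through y
  -- whose type (a) line contains A; sending y to the member of that line in
  -- the pencil at b is injective (perp-perp-meet-once again) between two sets
  -- of size s, hence onto; so B is hit.
  perp-join : ΠPt A → ΠPt B → Inc a A → Inc a X → Inc b B → Inc b X → a ≢ b →
              Σ Line λ Z → Admissible Z × PerpLine Z A × PerpLine Z B
  perp-join {A} {B} {a} {b} A∈Π B∈Π@(_ , ¬zB) aA aX bB bX a≢b =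
    let (y , _ , Z , _ , adm , A∈Z , B∈Z) =
          HasSize-onto (HasSize-remove (linePts Y) zY) (pencil-size bX)
                       (record { image = via-pencil-b ; injective = via-pencil-b-injective })
                       (bB , ΠPt≢X B∈Π)
    in Z , adm , A∈Z , B∈Z
    where
      ThroughY : Point → Line → Set
      ThroughY y W = Σ Line λ Z → Inc y Z × Admissible Z × PerpLine Z A × PerpLine Z W

      b≢z : b ≢ z
      b≢z refl = ¬zB bB

      via-pencil-b : Inc y Y × y ≢ z → Σ Line λ W → Pencil b W × ThroughY y W
      via-pencil-b (yY , y≢z) =
        let (Z , yZ , adm , A∈Z) = perp-through yY y≢z A∈Π
            (W , W∈Z , W∈b) = perp-meets-pencil adm bX b≢z
        in W , W∈b , Z , yZ , adm , A∈Z , W∈Z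

      via-pencil-b-injective : Inc y Y × y ≢ z → Inc y' Y × y' ≢ z → Pencil b W →
                               ThroughY y W → ThroughY y' W → y ≡ y'
      via-pencil-b-injective {W = W} (yY , _) (y'Y , _) (bW , W≢X)
                             (Z , yZ , adm , A∈Z , W∈Z) (Z' , y'Z' , adm' , A∈Z' , W∈Z') =
        decidable-stable (_ ≟ᶠ _) λ y≢y' →
          perp-perp-meet-once adm adm' (admissible-distinct adm yZ yY y'Z' y'Y y≢y') A≢W A∈Z W∈Z A∈Z' W∈Z'
        where
          A≢W : A ≢ W
          A≢W A≡W = W≢X (same-line a≢b (subst (Inc a) A≡W aA) bW aX bX)

  Key : Set
  Key = Line ⊎ Point

  ValidKey : Key → Set
  ValidKey (inj₁ Z) = Admissible Z
  ValidKey (inj₂ u) = Inc u X × u ≢ z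

  Member : Key → Line → Set
  Member (inj₁ Z) = PerpLine Z
  Member (inj₂ u) = Pencil u

  Member? : ∀ k W → Dec (Member k W)
  Member? (inj₁ Z) = PerpLine? Z
  Member? (inj₂ u) = Pencil? u

  Disjoint : Key → Key → Set
  Disjoint k k' = ∀ W → Member k W → ¬ Member k' W

  private
    variable
      k k' k₁ k₂ : Key

  member-ΠPt : ValidKey k → Member k W → ΠPt W
  member-ΠPt {inj₁ Z} = perpLine-ΠPt
  member-ΠPt {inj₂ u} (uX , u≢z) = pencil-ΠPt uX u≢z

  member-size : ValidKey k → HasSize nl (Member k) s
  member-size {inj₁ Z} = perpLine-size
  member-size {inj₂ u} (uX , _) = pencil-size uX

  pencil-key : ΠPt A → Inc a A → Inc a X → ValidKey (inj₂ a) × Member (inj₂ a) A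
  pencil-key A∈Π@(_ , ¬zA) aA aX = (aX , λ a≡z → ¬zA (subst (λ w → Inc w _) a≡z aA)) , aA , ΠPt≢X A∈Π

  join : ΠPt A → ΠPt B → Σ Key λ k → ValidKey k × Member k A × Member k B
  join A∈Π@((a , aA , aX) , _) B∈Π@((b , bB , bX) , _) with a ≟ᶠ b
  ... | yes refl = let (valid , A∈a) = pencil-key A∈Π aA aX
                   in inj₂ a , valid , A∈a , proj₂ (pencil-key B∈Π bB bX)
  ... | no a≢b = let (Z , adm , A∈Z , B∈Z) = perp-join A∈Π B∈Π aA aX bB bX a≢b
                 in inj₁ Z , adm , A∈Z , B∈Z

  join-unique : ValidKey k → ValidKey k' → A ≢ B →
                Member k A → Member k B → Member k' A → Member k' B → k ≡ k'
  join-unique {inj₁ Z} {inj₁ Z'} adm adm' A≢B A∈Z B∈Z A∈Z' B∈Z' =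
    cong inj₁ (decidable-stable (Z ≟ᶠ Z') λ Z≢Z' →
                 perp-perp-meet-once adm adm' Z≢Z' A≢B A∈Z B∈Z A∈Z' B∈Z')
  join-unique {inj₁ Z} {inj₂ u} adm (uX , _) A≢B A∈Z B∈Z (uA , _) (uB , _) =
    ⊥-elim (perp-pencil-meet-once adm uX A≢B uA uB A∈Z B∈Z)
  join-unique {inj₂ u} {inj₁ Z} (uX , _) adm A≢B (uA , _) (uB , _) A∈Z B∈Z =
    ⊥-elim (perp-pencil-meet-once adm uX A≢B uA uB A∈Z B∈Z)
  join-unique {inj₂ u} {inj₂ u'} (uX , _) (u'X , _) _ A∈u _ A∈u' _ =
    cong inj₂ (pencil-unique uX u'X A∈u A∈u')

  -- Through a Π-point off a line there is a line disjoint from it: for a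
  -- pencil, the pencil at the point where A meets X; for the type (a) line of
  -- Z, the type (a) line through A of the admissible line through Z ∩ Y.
  parallel : ValidKey k → ΠPt A → ¬ Member k A →
             Σ Key λ k' → ValidKey k' × Member k' A × Disjoint k' k
  parallel {inj₂ u} (uX , _) A∈Π@((a , aA , aX) , _) A∉u =
    let (valid , A∈a) = pencil-key A∈Π aA aX
    in inj₂ a , valid , A∈a ,
       λ W W∈a W∈u → A∉u (subst (λ v → Pencil v _) (pencil-unique aX uX W∈a W∈u) A∈a)
  parallel {inj₁ Z} adm@((y , yZ , yY) , ¬zZ) A∈Π A∉Z =
    let (Z' , yZ' , adm' , A∈Z') = perp-through yY (λ y≡z → ¬zZ (subst (λ w → Inc w Z) y≡z yZ)) A∈Π
    in inj₁ Z' , adm' , A∈Z' ,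
       λ W W∈Z' W∈Z → perps-through-y-disjoint adm' adm
                         (λ Z'≡Z → A∉Z (subst (λ v → PerpLine v _) Z'≡Z A∈Z')) yZ' yZ yY W∈Z' W∈Z

  perp-pencil-cross : Admissible Z → Inc u X → u ≢ z → Disjoint (inj₁ Z) (inj₂ u) → ⊥
  perp-pencil-cross adm uX u≢z disjoint =
    let (W , W∈Z , W∈u) = perp-meets-pencil adm uX u≢z in disjoint W W∈Z W∈u

  pencil-perp-cross : Admissible Z → Inc u X → u ≢ z → Disjoint (inj₂ u) (inj₁ Z) → ⊥
  pencil-perp-cross adm uX u≢z disjoint =
    let (W , W∈Z , W∈u) = perp-meets-pencil adm uX u≢z in disjoint W W∈u W∈Z

  parallel-perps-share-y : Admissible Z → Admissible Z₁ → Inc y Z → Inc y Y →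
                           Disjoint (inj₁ Z₁) (inj₁ Z) → Inc y Z₁
  parallel-perps-share-y {y = y} adm adm₁@((y₁ , y₁Z₁ , y₁Y) , _) yZ yY disjoint with y₁ ≟ᶠ y
  ... | yes refl = y₁Z₁
  ... | no y₁≢y = let (W , W∈Z₁ , W∈Z) = perps-meet adm₁ adm y₁Z₁ y₁Y yZ yY y₁≢y
                  in ⊥-elim (disjoint W W∈Z₁ W∈Z)

  -- The line through a Π-point parallel to a given line is unique: the type
  -- (b) lines form one parallel class, and the type (a) lines through a fixed
  -- point of Y another.
  parallel-unique : ValidKey k → ValidKey k₁ → ValidKey k₂ →
                    Member k₁ A → Disjoint k₁ k → Member k₂ A → Disjoint k₂ k → k₁ ≡ k₂
  parallel-unique {inj₂ u} {inj₂ u₁} {inj₂ u₂} _ (u₁X , _) (u₂X , _) A∈u₁ _ A∈u₂ _ =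
    cong inj₂ (pencil-unique u₁X u₂X A∈u₁ A∈u₂)
  parallel-unique {inj₂ u} {inj₁ _} (uX , u≢z) adm₁ _ _ d₁ _ _ =
    ⊥-elim (perp-pencil-cross adm₁ uX u≢z d₁)
  parallel-unique {inj₂ u} {inj₂ _} {inj₁ _} (uX , u≢z) _ adm₂ _ _ _ d₂ =
    ⊥-elim (perp-pencil-cross adm₂ uX u≢z d₂)
  parallel-unique {inj₁ _} {inj₂ _} adm (u₁X , u₁≢z) _ _ d₁ _ _ =
    ⊥-elim (pencil-perp-cross adm u₁X u₁≢z d₁)
  parallel-unique {inj₁ _} {inj₁ _} {inj₂ _} adm _ (u₂X , u₂≢z) _ _ _ d₂ =
    ⊥-elim (pencil-perp-cross adm u₂X u₂≢z d₂)
  parallel-unique {inj₁ Z} {inj₁ Z₁} {inj₁ Z₂} adm@((y , yZ , yY) , _) adm₁ adm₂ A∈Z₁ d₁ A∈Z₂ d₂ =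
    cong inj₁ (decidable-stable (Z₁ ≟ᶠ Z₂) λ Z₁≢Z₂ →
      perps-through-y-disjoint adm₁ adm₂ Z₁≢Z₂ (parallel-perps-share-y adm adm₁ yZ yY d₁)
                               (parallel-perps-share-y adm adm₂ yZ yY d₂) yY A∈Z₁ A∈Z₂)

  -- Three non-collinear Π-points: two lines A, B through a point u₁ ≠ z of X
  -- and a line C through another point u₂ ≠ z of X.
  noncollinear : 2 ≤ s → Σ Line λ A → Σ Line λ B → Σ Line λ C → ΠPt A × ΠPt B × ΠPt C ×
                 (∀ k → ValidKey k → Member k A → Member k B → ¬ Member k C)
  noncollinear 2≤s =
    let (u₁ , u₂ , (u₁X , u₁≢z) , (u₂X , u₂≢z) , u₁≢u₂) =
          HasSize-two (HasSize-remove (linePts X) zX) 2≤s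
        (A , B , A∈u₁ , B∈u₁ , A≢B) = HasSize-two (pencil-size u₁X) 2≤s
        (C , _ , C∈u₂ , _) = HasSize-two (pencil-size u₂X) 2≤s
    in A , B , C ,
       pencil-ΠPt u₁X u₁≢z A∈u₁ , pencil-ΠPt u₁X u₁≢z B∈u₁ , pencil-ΠPt u₂X u₂≢z C∈u₂ ,
       λ k valid A∈k B∈k C∈k →
         let k≡u₁ = join-unique {k' = inj₂ u₁} valid (u₁X , u₁≢z) A≢B A∈k B∈k A∈u₁ B∈u₁
         in u₁≢u₂ (pencil-unique u₁X u₂X (subst (λ k → Member k C) k≡u₁ C∈k) C∈u₂)

  Represents : Subset nl → Key → Set
  Represents S k = ∀ W → W ∈ S ⇔ Member k W

  describe : ∀ {S} → ΠLine Γ z X Y S → Σ Key λ k → ValidKey k × Represents S k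
  describe (inj₁ (Z , ZY , ¬zZ , S⇔)) = inj₁ Z , (ZY , ¬zZ) , S⇔
  describe (inj₂ (u , uX , u≢z , S⇔)) = inj₂ u , (uX , u≢z) , S⇔

  realise : ValidKey k → Σ (Subset nl) λ S → ΠLine Γ z X Y S × Represents S k
  realise {inj₁ Z} (ZY , ¬zZ) =
    let (S , S⇔) = comprehension (Member? (inj₁ Z)) in S , inj₁ (Z , ZY , ¬zZ , S⇔) , S⇔
  realise {inj₂ u} (uX , u≢z) =
    let (S , S⇔) = comprehension (Member? (inj₂ u)) in S , inj₂ (u , uX , u≢z , S⇔) , S⇔

  represents-unique : ∀ {S S'} → Represents S k → Represents S' k' → k ≡ k' → S ≡ S'
  represents-unique S⇔ S'⇔ refl = extensional S⇔ S'⇔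

  represents-disjoint : ∀ {S S'} k k' → Represents S k → Represents S' k' →
                        (∀ W → W ∈ S' → W ∉ S) → Disjoint k' k
  represents-disjoint _ _ S⇔ S'⇔ S'∥S W W∈k' W∈k = S'∥S W (from (S'⇔ W) W∈k') (from (S⇔ W) W∈k)

  IsΠLine : Subset nl → Set
  IsΠLine = ΠLine Γ z X Y

  linesOfPoints : ∀ S → IsΠLine S → ∀ W → W ∈ S → ΠPt W
  linesOfPoints S S∈Π W W∈S = let (k , valid , S⇔) = describe S∈Π in member-ΠPt valid (to (S⇔ W) W∈S)

  joinExists : ∀ A B → ΠPt A → ΠPt B → A ≢ B → Σ (Subset nl) λ S → IsΠLine S × A ∈ S × B ∈ S
  joinExists A B A∈Π B∈Π _ =
    let (k , valid , A∈k , B∈k) = join A∈Π B∈Π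
        (S , S∈Π , S⇔) = realise valid
    in S , S∈Π , from (S⇔ A) A∈k , from (S⇔ B) B∈k

  joinUnique : ∀ A B → ΠPt A → ΠPt B → A ≢ B → ∀ S S' →
               IsΠLine S → A ∈ S → B ∈ S → IsΠLine S' → A ∈ S' → B ∈ S' → S ≡ S'
  joinUnique A B _ _ A≢B S S' S∈Π A∈S B∈S S'∈Π A∈S' B∈S' =
    let (k , valid , S⇔) = describe S∈Π
        (k' , valid' , S'⇔) = describe S'∈Π
    in represents-unique S⇔ S'⇔ (join-unique valid valid' A≢B (to (S⇔ A) A∈S) (to (S⇔ B) B∈S)
                                                             (to (S'⇔ A) A∈S') (to (S'⇔ B) B∈S'))

  parallelExists : ∀ S A → IsΠLine S → ΠPt A → A ∉ S →
                   Σ (Subset nl) λ S' → IsΠLine S' × A ∈ S' × (∀ W → W ∈ S' → W ∉ S)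
  parallelExists S A S∈Π A∈Π A∉S =
    let (k , valid , S⇔) = describe S∈Π
        (k' , valid' , A∈k' , disjoint) = parallel valid A∈Π (A∉S ∘ from (S⇔ A))
        (S' , S'∈Π , S'⇔) = realise valid'
    in S' , S'∈Π , from (S'⇔ A) A∈k' ,
       λ W W∈S' W∈S → disjoint W (to (S'⇔ W) W∈S') (to (S⇔ W) W∈S)

  parallelUnique : ∀ S A → IsΠLine S → ΠPt A → A ∉ S → ∀ S₁ S₂ →
                   IsΠLine S₁ → A ∈ S₁ → (∀ W → W ∈ S₁ → W ∉ S) →
                   IsΠLine S₂ → A ∈ S₂ → (∀ W → W ∈ S₂ → W ∉ S) → S₁ ≡ S₂
  parallelUnique S A S∈Π _ _ S₁ S₂ S₁∈Π A∈S₁ S₁∥S S₂∈Π A∈S₂ S₂∥S =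
    let (k , valid , S⇔) = describe S∈Π
        (k₁ , valid₁ , S₁⇔) = describe S₁∈Π
        (k₂ , valid₂ , S₂⇔) = describe S₂∈Π
    in represents-unique S₁⇔ S₂⇔
         (parallel-unique valid valid₁ valid₂
            (to (S₁⇔ A) A∈S₁) (represents-disjoint k k₁ S⇔ S₁⇔ S₁∥S)
            (to (S₂⇔ A) A∈S₂) (represents-disjoint k k₂ S⇔ S₂⇔ S₂∥S))

  nonDegenerate : 2 ≤ s → Σ Line λ A → Σ Line λ B → Σ Line λ C → ΠPt A × ΠPt B × ΠPt C ×
                  (∀ S → IsΠLine S → A ∈ S → B ∈ S → C ∉ S)
  nonDegenerate 2≤s =
    let (A , B , C , A∈Π , B∈Π , C∈Π , ¬collinear) = noncollinear 2≤s
    in A , B , C , A∈Π , B∈Π , C∈Π , λ S S∈Π A∈S B∈S C∈S →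
         let (k , valid , S⇔) = describe S∈Π
         in ¬collinear k valid (to (S⇔ A) A∈S) (to (S⇔ B) B∈S) (to (S⇔ C) C∈S)

  order : ∀ S → IsΠLine S → ∣ S ∣ ≡ s
  order S S∈Π = let (k , valid , S⇔) = describe S∈Π in represented-size S⇔ (member-size valid)

mainTheorem19 : (s : ℕ) (Γ : GQ s s) → 2 ≤ s →
    (X Y : Fin (GQ.nl Γ)) (z : Fin (GQ.np Γ)) → X ≢ Y →
    GQ.Inc Γ z X → GQ.Inc Γ z Y → AR1 Γ z X Y →
    IsAffinePlane (GQ.nl Γ) (ΠPoint Γ z X) (ΠLine Γ z X Y) s
mainTheorem19 s Γ 2≤s X Y z X≢Y zX zY ar1 = record
  { linesOfPoints  = linesOfPoints
  ; joinExists     = joinExists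
  ; joinUnique     = joinUnique
  ; parallelExists = parallelExists
  ; parallelUnique = parallelUnique
  ; nonDegenerate  = nonDegenerate 2≤s
  ; order          = order
  }
  where open Configuration Γ X Y z X≢Y zX zY ar1
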